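{- Let $T$ be a rooted ordered tree, let $X=[X[1],\ldots,X[k]]$ be an ordered list of nodes of $T$, and let $x$ be an ancestor of $X[i]$ for some $i\in\{1,\ldots,k\}$. If $x$ is an ancestor of some node in $X$ other than $X[i]$, then $x$ is an ancestor of $X[i-1]$ or of $X[i+1]$.
   Context: With $\mathrm{pre}$ and $\mathrm{post}$ the preorder and postorder numbers in $T$, $u\lhd w$ means $\mathrm{pre}(u)<\mathrm{pre}(w)$ and $\mathrm{post}(u)<\mathrm{post}(w)$. A list $X$ of nodes is ordered if $X[j]\lhd X[j+1]$ for all $1\le j\le k-1$. Ancestor includes the node itself. -}

module Defs where

open import Data.Nat using (ℕ; zero; suc; _<_)
open import Data.Nat.Properties using () renaming (_≟_ to _≟ℕ_)
open import Data.List using (List; []; _∷_; _++_; map; [_])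
open import Data.List.Properties using (≡-dec)
open import Data.List.Membership.Propositional using (_∈_)
open import Data.Product using (Σ; ∃; _×_)
open import Relation.Nullary using (yes; no)
open import Relation.Binary.PropositionalEquality using (_≡_)

data Tree : Set where
  node : List Tree → Tree

-- A node of a tree is identified by its position: the list of child
-- indices (0-based) along the path from the root.  The root is [].
Pos : Set
Pos = List ℕ

mutual
  preorderList : Tree → List Pos
  preorderList (node ts) = [] ∷ preorderForest 0 ts

  preorderForest : ℕ → List Tree → List Pos
  preorderForest i [] = []
  preorderForest i (t ∷ ts) = map (i ∷_) (preorderList t) ++ preorderForest (suc i) ts

mutual
  postorderList : Tree → List Pos
  postorderList (node ts) = postorderForest 0 ts ++ [ [] ]

  postorderForest : ℕ → List Tree → List Pos
  postorderForest i [] = []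
  postorderForest i (t ∷ ts) = map (i ∷_) (postorderList t) ++ postorderForest (suc i) ts

NodeOf : Tree → Pos → Set
NodeOf T u = u ∈ preorderList T

indexOf : Pos → List Pos → ℕ
indexOf p [] = 0
indexOf p (q ∷ qs) with ≡-dec _≟ℕ_ p q
... | yes _ = 0
... | no _ = suc (indexOf p qs)

pre : Tree → Pos → ℕ
pre T u = indexOf u (preorderList T)

post : Tree → Pos → ℕ
post T u = indexOf u (postorderList T)

_⊢_◁_ : Tree → Pos → Pos → Set
T ⊢ u ◁ w = (pre T u < pre T w) × (post T u < post T w)

Ancestor : Pos → Pos → Set
Ancestor u w = ∃ λ s → u ++ s ≡ w

{-# OPTIONS --safe #-}
module Submission where

-- The preorder lists u before w exactly when u is a proper prefix of w or lies
-- to its left; the postorder lists u before w exactly when w is a proper prefix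
-- of u or u lies to its left.  Hence, for nodes x and v, x is an ancestor of v
-- iff pre x ≤ pre v and post v ≤ post x.  Along the ordered list both numbers
-- increase, so if x is an ancestor of X[i] and of X[j] with i < j, then
-- pre x ≤ pre X[i] < pre X[i+1] and post X[i+1] ≤ post X[j] ≤ post x, i.e.
-- x is an ancestor of X[i+1]; the case j < i is symmetric.

open import Defs
open import Function using (_∘_; id)
open import Data.Nat using (ℕ; suc; _+_; _≤_; _<_; _≤′_; ≤′-reflexive; ≤′-step; s≤s; s≤s⁻¹; z<s)
open import Data.Nat.Properties
open import Data.Fin using (Fin; zero; suc; toℕ; fromℕ<; inject₁)
open import Data.Fin.Properties using (toℕ-injective; toℕ-fromℕ<; toℕ-inject₁; toℕ<n)
open import Data.List using (List; []; _∷_; _++_; map; [_]; length)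
open import Data.List.Properties using (≡-dec; ++-identityʳ; ∷-injectiveʳ)
open import Data.List.Membership.Propositional using (_∈_; _∉_)
open import Data.List.Membership.Propositional.Properties using (∈-map⁺; ∈-map⁻; ∈-++⁺ˡ; ∈-++⁺ʳ; ∈-++⁻)
open import Data.List.Relation.Unary.Any using (here; there)
open import Data.List.Relation.Unary.All using (All; []; _∷_)
open import Data.List.Relation.Binary.Subset.Propositional using (_⊆_)
open import Data.List.Relation.Binary.Subset.Propositional.Properties using (map⁺; ++⁺)
open import Data.Product using (∃; ∃₂; _×_; _,_; proj₁; proj₂)
open import Data.Sum using (_⊎_; inj₁; inj₂) renaming (map to ⊎-map)
open import Data.Empty using (⊥-elim)
open import Relation.Nullary using (¬_; yes; no)
open import Relation.Binary using (tri<; tri≈; tri>)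
open import Relation.Binary.PropositionalEquality using (_≡_; refl; sym; trans; cong; subst; subst₂)

infix 4 _⊏_ _≺_ _<pre_ _<post_

data _⊏_ : Pos → Pos → Set where
  halt : ∀ {b w} → [] ⊏ b ∷ w
  next : ∀ {a u w} → u ⊏ w → a ∷ u ⊏ a ∷ w

data _≺_ : Pos → Pos → Set where
  this : ∀ {a b u w} → a < b → a ∷ u ≺ b ∷ w
  next : ∀ {a u w} → u ≺ w → a ∷ u ≺ a ∷ w

_<pre_ : Pos → Pos → Set
u <pre w = u ⊏ w ⊎ u ≺ w

_<post_ : Pos → Pos → Set
u <post w = w ⊏ u ⊎ u ≺ w

data Comparison (u w : Pos) : Set where
  equal     : u ≡ w → Comparison u w
  prefix    : u ⊏ w → Comparison u w
  extension : w ⊏ u → Comparison u w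
  left      : u ≺ w → Comparison u w
  right     : w ≺ u → Comparison u w

compare : ∀ u w → Comparison u w
compare []      []      = equal refl
compare []      (_ ∷ _) = prefix halt
compare (_ ∷ _) []      = extension halt
compare (a ∷ u) (b ∷ w) with <-cmp a b
... | tri< a<b _ _ = left (this a<b)
... | tri> _ _ b<a = right (this b<a)
... | tri≈ _ refl _ with compare u w
...   | equal u≡w     = equal (cong (a ∷_) u≡w)
...   | prefix u⊏w    = prefix (next u⊏w)
...   | extension w⊏u = extension (next w⊏u)
...   | left u≺w      = left (next u≺w)
...   | right w≺u     = right (next w≺u)

⊏-head : ∀ {a b u w} → a ∷ u ⊏ b ∷ w → a ≡ b
⊏-head (next _) = refl

⊏-tail : ∀ {a u w} → a ∷ u ⊏ a ∷ w → u ⊏ w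
⊏-tail (next u⊏w) = u⊏w

≺-head : ∀ {a b u w} → a ∷ u ≺ b ∷ w → a ≤ b
≺-head (this a<b) = <⇒≤ a<b
≺-head (next _)   = ≤-refl

≺-tail : ∀ {a u w} → a ∷ u ≺ a ∷ w → u ≺ w
≺-tail (this a<a)  = ⊥-elim (<-irrefl refl a<a)
≺-tail (next u≺w) = u≺w

<pre-head : ∀ {a b u w} → a ∷ u <pre b ∷ w → a ≤ b
<pre-head (inj₁ p) = ≤-reflexive (⊏-head p)
<pre-head (inj₂ l) = ≺-head l

<post-head : ∀ {a b u w} → a ∷ u <post b ∷ w → a ≤ b
<post-head (inj₁ p) = ≤-reflexive (sym (⊏-head p))
<post-head (inj₂ l) = ≺-head l

Ancestor-refl : ∀ u → Ancestor u u
Ancestor-refl u = [] , ++-identityʳ u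

⊏⇒Ancestor : ∀ {u v} → u ⊏ v → Ancestor u v
⊏⇒Ancestor (halt {b} {w}) = b ∷ w , refl
⊏⇒Ancestor (next u⊏v) with ⊏⇒Ancestor u⊏v
... | s , refl = s , refl

Ancestor⇒≡⊎⊏ : ∀ {u v} → Ancestor u v → u ≡ v ⊎ u ⊏ v
Ancestor⇒≡⊎⊏ {[]}    ([]    , refl) = inj₁ refl
Ancestor⇒≡⊎⊏ {[]}    (_ ∷ _ , refl) = inj₂ halt
Ancestor⇒≡⊎⊏ {a ∷ u} (s     , refl) =
  ⊎-map (cong (a ∷_)) next (Ancestor⇒≡⊎⊏ {u} (s , refl))

indexOf-++-∈ : ∀ {p} L R → p ∈ L → indexOf p (L ++ R) ≡ indexOf p L
indexOf-++-∈ {p} (q ∷ L) R p∈ with ≡-dec _≟_ p q | p∈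
... | yes _  | _         = refl
... | no p≢q | here p≡q  = ⊥-elim (p≢q p≡q)
... | no _   | there p∈L = cong suc (indexOf-++-∈ L R p∈L)

indexOf-++-∉ : ∀ {p} L R → p ∉ L → indexOf p (L ++ R) ≡ length L + indexOf p R
indexOf-++-∉ []      R p∉ = refl
indexOf-++-∉ {p} (q ∷ L) R p∉ with ≡-dec _≟_ p q
... | yes p≡q = ⊥-elim (p∉ (here p≡q))
... | no _    = cong suc (indexOf-++-∉ L R (p∉ ∘ there))

indexOf<length : ∀ {p} L → p ∈ L → indexOf p L < length L
indexOf<length {p} (q ∷ L) p∈ with ≡-dec _≟_ p q | p∈
... | yes _  | _         = z<s
... | no p≢q | here p≡q  = ⊥-elim (p≢q p≡q)
... | no _   | there p∈L = s≤s (indexOf<length L p∈L)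

indexOf-++-< : ∀ {u w} L R → u ∈ L → w ∉ L → indexOf u (L ++ R) < indexOf w (L ++ R)
indexOf-++-< {u} {w} L R u∈ w∉ = begin-strict
  indexOf u (L ++ R)       ≡⟨ indexOf-++-∈ L R u∈ ⟩
  indexOf u L              <⟨ indexOf<length L u∈ ⟩
  length L                 ≤⟨ m≤m+n (length L) _ ⟩
  length L + indexOf w R   ≡⟨ indexOf-++-∉ L R w∉ ⟨
  indexOf w (L ++ R)       ∎
  where open ≤-Reasoning

indexOf-map-∷ : ∀ i p L → indexOf (i ∷ p) (map (i ∷_) L) ≡ indexOf p L
indexOf-map-∷ i p [] = refl
indexOf-map-∷ i p (q ∷ L) with ≡-dec _≟_ p q | ≡-dec _≟_ (i ∷ p) (i ∷ q)
... | yes _   | yes _   = refl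
... | yes p≡q | no ip≢iq = ⊥-elim (ip≢iq (cong (i ∷_) p≡q))
... | no p≢q  | yes ip≡iq = ⊥-elim (p≢q (∷-injectiveʳ ip≡iq))
... | no _    | no _    = cong suc (indexOf-map-∷ i p L)

forest : (Tree → List Pos) → ℕ → List Tree → List Pos
forest f i []       = []
forest f i (t ∷ ts) = map (i ∷_) (f t) ++ forest f (suc i) ts

preorderForest≡forest : ∀ i ts → preorderForest i ts ≡ forest preorderList i ts
preorderForest≡forest i []       = refl
preorderForest≡forest i (t ∷ ts) =
  cong (map (i ∷_) (preorderList t) ++_) (preorderForest≡forest (suc i) ts)

postorderForest≡forest : ∀ i ts → postorderForest i ts ≡ forest postorderList i ts
postorderForest≡forest i []       = refl
postorderForest≡forest i (t ∷ ts) =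
  cong (map (i ∷_) (postorderList t) ++_) (postorderForest≡forest (suc i) ts)

∈-forest⁻ : ∀ {u} f i t ts → u ∈ forest f i (t ∷ ts) →
  (∃ λ u′ → u′ ∈ f t × u ≡ i ∷ u′) ⊎ u ∈ forest f (suc i) ts
∈-forest⁻ f i t ts = ⊎-map (∈-map⁻ (i ∷_)) id ∘ ∈-++⁻ (map (i ∷_) (f t))

∈-forest⇒head≥ : ∀ {u} f i ts → u ∈ forest f i ts → ∃₂ λ a u′ → u ≡ a ∷ u′ × i ≤ a
∈-forest⇒head≥ f i (t ∷ ts) u∈ with ∈-forest⁻ f i t ts u∈
... | inj₁ (u′ , _ , refl) = i , u′ , refl , ≤-refl
... | inj₂ u∈ʳ with ∈-forest⇒head≥ f (suc i) ts u∈ʳ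
...   | a , u′ , refl , i<a = a , u′ , refl , <⇒≤ i<a

[]∉forest : ∀ f i ts → [] ∉ forest f i ts
[]∉forest f i ts []∈ with ∈-forest⇒head≥ f i ts []∈
... | _ , _ , () , _

later∉block : ∀ {u} f i ts L → u ∈ forest f (suc i) ts → u ∉ map (i ∷_) L
later∉block f i ts L u∈ u∈blk with ∈-forest⇒head≥ f (suc i) ts u∈ | ∈-map⁻ (i ∷_) u∈blk
... | _ , _ , refl , i<i | _ , _ , refl = <-irrefl refl i<i

indexOf-block : ∀ i {p} L R → p ∈ L → indexOf (i ∷ p) (map (i ∷_) L ++ R) ≡ indexOf p L
indexOf-block i {p} L R p∈ =
  trans (indexOf-++-∈ (map (i ∷_) L) R (∈-map⁺ (i ∷_) p∈)) (indexOf-map-∷ i p L)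

forest-⊆ : ∀ {f g} i ts → All (λ t → f t ⊆ g t) ts → forest f i ts ⊆ forest g i ts
forest-⊆ i []       []               = λ ()
forest-⊆ i (t ∷ ts) (t⊆ ∷ ts⊆) = ++⁺ (map⁺ (i ∷_) t⊆) (forest-⊆ (suc i) ts ts⊆)

SortedBy : (Pos → Pos → Set) → List Pos → Set
SortedBy R L = ∀ {u w} → u ∈ L → w ∈ L → R u w → indexOf u L < indexOf w L

module ForestOrder (R : Pos → Pos → Set)
  (R-head : ∀ {a b u w} → R (a ∷ u) (b ∷ w) → a ≤ b)
  (R-tail : ∀ {a u w} → R (a ∷ u) (a ∷ w) → R u w) where

  forest-sortedBy : ∀ f i ts → All (SortedBy R ∘ f) ts → SortedBy R (forest f i ts)
  forest-sortedBy f i (t ∷ ts) (t-sorted ∷ ts-sorted) u∈ w∈ uRw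
    with ∈-forest⁻ f i t ts u∈ | ∈-forest⁻ f i t ts w∈
  ... | inj₁ (u′ , u′∈ , refl) | inj₁ (w′ , w′∈ , refl) =
    subst₂ _<_ (sym (indexOf-block i (f t) _ u′∈)) (sym (indexOf-block i (f t) _ w′∈))
      (t-sorted u′∈ w′∈ (R-tail uRw))
  ... | inj₁ (u′ , u′∈ , refl) | inj₂ w∈ʳ =
    indexOf-++-< (map (i ∷_) (f t)) _ (∈-map⁺ (i ∷_) u′∈) (later∉block f i ts (f t) w∈ʳ)
  ... | inj₂ u∈ʳ | inj₁ (_ , _ , refl) with ∈-forest⇒head≥ f (suc i) ts u∈ʳ
  ...   | _ , _ , refl , i<a = ⊥-elim (<⇒≱ i<a (R-head uRw))
  forest-sortedBy f i (t ∷ ts) (_ ∷ ts-sorted) _ _ uRw | inj₂ u∈ʳ | inj₂ w∈ʳ =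
    subst₂ _<_ (sym (indexOf-++-∉ L _ (later∉block f i ts (f t) u∈ʳ)))
               (sym (indexOf-++-∉ L _ (later∉block f i ts (f t) w∈ʳ)))
      (+-monoʳ-< (length L) (forest-sortedBy f (suc i) ts ts-sorted u∈ʳ w∈ʳ uRw))
    where L = map (i ∷_) (f t)

module Pre  = ForestOrder _<pre_  <pre-head  (⊎-map ⊏-tail ≺-tail)
module Post = ForestOrder _<post_ <post-head (⊎-map ⊏-tail ≺-tail)

mutual
  preorder-sorted : ∀ t → SortedBy _<pre_ (preorderList t)
  preorder-sorted (node ts) {[]}    {_ ∷ _} _ _ _ = z<s
  preorder-sorted (node ts) {[]}    {[]}    _ _ (inj₁ ())
  preorder-sorted (node ts) {[]}    {[]}    _ _ (inj₂ ())
  preorder-sorted (node ts) {_ ∷ _} {[]}    _ _ (inj₁ ())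
  preorder-sorted (node ts) {_ ∷ _} {[]}    _ _ (inj₂ ())
  preorder-sorted (node ts) {_ ∷ _} {_ ∷ _} (here ()) _ _
  preorder-sorted (node ts) {_ ∷ _} {_ ∷ _} (there _) (here ()) _
  preorder-sorted (node ts) {_ ∷ _} {_ ∷ _} (there u∈) (there w∈) u<w =
    s≤s (children-sorted u∈ w∈ u<w)
    where
    children-sorted : SortedBy _<pre_ (preorderForest 0 ts)
    children-sorted = subst (SortedBy _<pre_) (sym (preorderForest≡forest 0 ts))
      (Pre.forest-sortedBy preorderList 0 ts (all-preorder-sorted ts))

  all-preorder-sorted : ∀ ts → All (SortedBy _<pre_ ∘ preorderList) ts
  all-preorder-sorted []       = []
  all-preorder-sorted (t ∷ ts) = preorder-sorted t ∷ all-preorder-sorted ts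

∷∈-++-[[]]⁻ : ∀ {a : ℕ} {u : Pos} L → a ∷ u ∈ L ++ [ [] ] → a ∷ u ∈ L
∷∈-++-[[]]⁻ L au∈ with ∈-++⁻ L au∈
... | inj₁ au∈L        = au∈L
... | inj₂ (here ())
... | inj₂ (there ())

mutual
  postorder-sorted : ∀ t → SortedBy _<post_ (postorderList t)
  postorder-sorted (node ts) {[]}    _ _ (inj₁ ())
  postorder-sorted (node ts) {[]}    _ _ (inj₂ ())
  postorder-sorted (node ts) {_ ∷ _} {[]} u∈ _ _ =
    indexOf-++-< F [ [] ] (∷∈-++-[[]]⁻ F u∈) ([]∉children)
    where
    F = postorderForest 0 ts
    []∉children : [] ∉ F
    []∉children = subst ([] ∉_) (sym (postorderForest≡forest 0 ts)) ([]∉forest postorderList 0 ts)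
  postorder-sorted (node ts) {_ ∷ _} {_ ∷ _} u∈ w∈ u<w =
    subst₂ _<_ (sym (indexOf-++-∈ F [ [] ] u∈F)) (sym (indexOf-++-∈ F [ [] ] w∈F))
      (children-sorted u∈F w∈F u<w)
    where
    F = postorderForest 0 ts
    u∈F = ∷∈-++-[[]]⁻ F u∈
    w∈F = ∷∈-++-[[]]⁻ F w∈
    children-sorted : SortedBy _<post_ F
    children-sorted = subst (SortedBy _<post_) (sym (postorderForest≡forest 0 ts))
      (Post.forest-sortedBy postorderList 0 ts (all-postorder-sorted ts))

  all-postorder-sorted : ∀ ts → All (SortedBy _<post_ ∘ postorderList) ts
  all-postorder-sorted []       = []
  all-postorder-sorted (t ∷ ts) = postorder-sorted t ∷ all-postorder-sorted ts

mutual
  preorder⊆postorder : ∀ t → preorderList t ⊆ postorderList t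
  preorder⊆postorder (node ts) (here refl) = ∈-++⁺ʳ (postorderForest 0 ts) (here refl)
  preorder⊆postorder (node ts) (there u∈)  = ∈-++⁺ˡ (children⊆ u∈)
    where
    children⊆ : preorderForest 0 ts ⊆ postorderForest 0 ts
    children⊆ = subst₂ _⊆_ (sym (preorderForest≡forest 0 ts)) (sym (postorderForest≡forest 0 ts))
      (forest-⊆ 0 ts (all-preorder⊆postorder ts))

  all-preorder⊆postorder : ∀ ts → All (λ t → preorderList t ⊆ postorderList t) ts
  all-preorder⊆postorder []       = []
  all-preorder⊆postorder (t ∷ ts) = preorder⊆postorder t ∷ all-preorder⊆postorder ts

module _ {T : Tree} where

  pre-< : ∀ {u w} → NodeOf T u → NodeOf T w → u <pre w → pre T u < pre T w
  pre-< = preorder-sorted T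

  post-< : ∀ {u w} → NodeOf T u → NodeOf T w → u <post w → post T u < post T w
  post-< u∈ w∈ = postorder-sorted T (preorder⊆postorder T u∈) (preorder⊆postorder T w∈)

  Encloses : Pos → Pos → Set
  Encloses x v = pre T x ≤ pre T v × post T v ≤ post T x

  ancestor⇒encloses : ∀ {x v} → NodeOf T x → NodeOf T v → Ancestor x v → Encloses x v
  ancestor⇒encloses x∈ v∈ x≼v with Ancestor⇒≡⊎⊏ x≼v
  ... | inj₁ refl = ≤-refl , ≤-refl
  ... | inj₂ x⊏v  = <⇒≤ (pre-< x∈ v∈ (inj₁ x⊏v)) , <⇒≤ (post-< v∈ x∈ (inj₁ x⊏v))

  encloses⇒ancestor : ∀ {x v} → NodeOf T x → NodeOf T v → Encloses x v → Ancestor x v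
  encloses⇒ancestor {x} {v} x∈ v∈ (pre≤ , post≥) with compare x v
  ... | equal refl    = Ancestor-refl x
  ... | prefix x⊏v    = ⊏⇒Ancestor x⊏v
  ... | extension v⊏x = ⊥-elim (<⇒≱ (pre-< v∈ x∈ (inj₁ v⊏x)) pre≤)
  ... | left x≺v      = ⊥-elim (<⇒≱ (post-< x∈ v∈ (inj₂ x≺v)) post≥)
  ... | right v≺x     = ⊥-elim (<⇒≱ (pre-< v∈ x∈ (inj₂ v≺x)) pre≤)

StepIncreasing : ∀ {k} → (Fin k → ℕ) → Set
StepIncreasing f = ∀ j j′ → suc (toℕ j) ≡ toℕ j′ → f j < f j′

stepIncreasing⇒monotone : ∀ {k} {f : Fin k → ℕ} → StepIncreasing f →
  ∀ {m n} → toℕ m ≤ toℕ n → f m ≤ f n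
stepIncreasing⇒monotone {f = f} inc {m} m≤n = go (≤⇒≤′ m≤n) _ refl
  where
  go : ∀ {c} → toℕ m ≤′ c → ∀ n → toℕ n ≡ c → f m ≤ f n
  go (≤′-reflexive refl) n n≡m = ≤-reflexive (cong f (toℕ-injective (sym n≡m)))
  go (≤′-step _)   zero    ()
  go (≤′-step m≤c) (suc n) n≡c =
    ≤-trans (go m≤c (inject₁ n) (trans (toℕ-inject₁ n) (suc-injective n≡c)))
            (<⇒≤ (inc (inject₁ n) (suc n) (cong suc (toℕ-inject₁ n))))

successor : ∀ {k} {i j : Fin k} → toℕ i < toℕ j → ∃ λ (n : Fin k) → toℕ n ≡ suc (toℕ i)
successor {j = j} i<j = fromℕ< (<-≤-trans (s≤s i<j) (toℕ<n j)) , toℕ-fromℕ< _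

predecessor : ∀ {k} {j i : Fin k} → toℕ j < toℕ i → ∃ λ (p : Fin k) → suc (toℕ p) ≡ toℕ i
predecessor {i = suc i} _ = inject₁ i , cong suc (toℕ-inject₁ i)

module _ {T : Tree} {k : ℕ} {X : Fin k → Pos}
  (X∈T : ∀ j → NodeOf T (X j))
  (ordered : ∀ (j j′ : Fin k) → suc (toℕ j) ≡ toℕ j′ → T ⊢ X j ◁ X j′)
  {x : Pos} (x∈T : NodeOf T x) where

  private
    pre-increasing : StepIncreasing (pre T ∘ X)
    pre-increasing j j′ j+1≡j′ = proj₁ (ordered j j′ j+1≡j′)

    post-increasing : StepIncreasing (post T ∘ X)
    post-increasing j j′ j+1≡j′ = proj₂ (ordered j j′ j+1≡j′)

    encloses : ∀ {v} → Ancestor x (X v) → Encloses {T} x (X v)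
    encloses {v} = ancestor⇒encloses x∈T (X∈T v)

  ancestor-of-next : ∀ {i j n} → Ancestor x (X i) → Ancestor x (X j) →
    toℕ i < toℕ j → toℕ n ≡ suc (toℕ i) → Ancestor x (X n)
  ancestor-of-next {i} {j} {n} x≼Xi x≼Xj i<j n≡1+i = encloses⇒ancestor x∈T (X∈T n)
    ( ≤-trans (proj₁ (encloses x≼Xi)) (<⇒≤ (pre-increasing i n (sym n≡1+i)))
    , ≤-trans (stepIncreasing⇒monotone post-increasing (subst (_≤ toℕ j) (sym n≡1+i) i<j))
              (proj₂ (encloses x≼Xj)) )

  ancestor-of-previous : ∀ {i j p} → Ancestor x (X i) → Ancestor x (X j) →
    toℕ j < toℕ i → suc (toℕ p) ≡ toℕ i → Ancestor x (X p)
  ancestor-of-previous {i} {j} {p} x≼Xi x≼Xj j<i 1+p≡i = encloses⇒ancestor x∈T (X∈T p)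
    ( ≤-trans (proj₁ (encloses x≼Xj))
              (stepIncreasing⇒monotone pre-increasing (s≤s⁻¹ (subst (toℕ j <_) (sym 1+p≡i) j<i)))
    , ≤-trans (<⇒≤ (post-increasing p i 1+p≡i)) (proj₂ (encloses x≼Xi)) )

proposition4 : (T : Tree) (k : ℕ) (X : Fin k → Pos) →
    (∀ j → NodeOf T (X j)) →
    (∀ (j j′ : Fin k) → suc (toℕ j) ≡ toℕ j′ → T ⊢ X j ◁ X j′) →
    (x : Pos) → NodeOf T x → (i : Fin k) → Ancestor x (X i) →
    (∃ λ (j : Fin k) → ¬ (j ≡ i) × Ancestor x (X j)) →
    (∃ λ (j : Fin k) → suc (toℕ j) ≡ toℕ i × Ancestor x (X j))
      ⊎ (∃ λ (j : Fin k) → toℕ j ≡ suc (toℕ i) × Ancestor x (X j))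
proposition4 T k X X∈T ordered x x∈T i x≼Xi (j , j≢i , x≼Xj) with <-cmp (toℕ i) (toℕ j)
... | tri< i<j _ _ =
  let n , n≡1+i = successor i<j
  in inj₂ (n , n≡1+i , ancestor-of-next X∈T ordered x∈T x≼Xi x≼Xj i<j n≡1+i)
... | tri≈ _ i≡j _ = ⊥-elim (j≢i (toℕ-injective (sym i≡j)))
... | tri> _ _ j<i =
  let p , 1+p≡i = predecessor j<i
  in inj₁ (p , 1+p≡i , ancestor-of-previous X∈T ordered x∈T x≼Xi x≼Xj j<i 1+p≡i)
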